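{- Let $G$ and $G'$ be isomorphic simple connected graphs on $[n]$ whose Laplacian simplices are reflexive. Then the linear codes $\mathcal{C}(\mathcal{P}_G)$ and $\mathcal{C}(\mathcal{P}_{G'})$ are permutation equivalent.
   Context: The Laplacian matrix $L$ of a simple graph on $[n]$ has $L_{ii}=\deg(i)$, $L_{ij}=-1$ if $\{i,j\}$ is an edge and $0$ otherwise; $L(n)$ is $L$ with its $n$-th column deleted, and the Laplacian simplex $\mathcal{P}_G$ is the convex hull of the rows of $L(n)$. A lattice polytope is reflexive if it contains the origin in its interior and its dual is a lattice polytope. For reflexive $\mathcal{P}_G$, the associated linear code is $\mathcal{C}(\mathcal{P}_G)=\{\bar{\mathbf{x}}\in\mathbb{Z}_n^n\mid\bar{\mathbf{x}}[L(n)\mid\mathbb{1}]=\mathbf{0}\text{ in }\mathbb{Z}_n^n\}$, with $[L(n)\mid\mathbb{1}]$ being $L(n)$ with a column of ones appended. Two codes $\mathcal{C},\mathcal{C}'\subseteq\mathbb{Z}_n^n$ are permutation equivalent if there is $\sigma\in S_n$ with $(c_{\sigma(1)},\dots,c_{\sigma(n)})\in\mathcal{C}'$ for all $c\in\mathcal{C}$. -}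

module Defs where

open import Data.Nat as ℕ using (ℕ; zero; suc)
open import Data.Bool using (Bool; true; false; if_then_else_)
open import Data.Fin as Fin using (Fin; inject₁; toℕ)
open import Data.Fin.Permutation using (Permutation′; _⟨$⟩ʳ_)
open import Data.Integer as ℤ using (ℤ; +_; -[1+_])
open import Data.Integer.Divisibility using () renaming (_∣_ to _∣ℤ_)
open import Data.Rational as ℚ using (ℚ; 0ℚ; 1ℚ)
open import Data.Product using (Σ; _×_; _,_; ∃)
open import Relation.Binary.PropositionalEquality using (_≡_)
open import Relation.Nullary using (does)
open import Function.Bundles using (_⇔_)

Σℤ : ∀ {k} → (Fin k → ℤ) → ℤ
Σℤ {zero}  f = + 0
Σℤ {suc k} f = f Fin.zero ℤ.+ Σℤ (λ i → f (Fin.suc i))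

Σℕ : ∀ {k} → (Fin k → ℕ) → ℕ
Σℕ {zero}  f = 0
Σℕ {suc k} f = f Fin.zero ℕ.+ Σℕ (λ i → f (Fin.suc i))

Σℚ : ∀ {k} → (Fin k → ℚ) → ℚ
Σℚ {zero}  f = 0ℚ
Σℚ {suc k} f = f Fin.zero ℚ.+ Σℚ (λ i → f (Fin.suc i))

record SimpleGraph (n : ℕ) : Set where
  field
    adj     : Fin n → Fin n → Bool
    symm    : ∀ i j → adj i j ≡ adj j i
    irrefl  : ∀ i → adj i i ≡ false
open SimpleGraph public

data Reachable {n : ℕ} (G : SimpleGraph n) : Fin n → Fin n → Set where
  here : ∀ {i} → Reachable G i i
  step : ∀ {i j k} → adj G i j ≡ true → Reachable G j k → Reachable G i k

Connected : ∀ {n} → SimpleGraph n → Set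
Connected {n} G = ∀ (i j : Fin n) → Reachable G i j

Isomorphic : ∀ {n} → SimpleGraph n → SimpleGraph n → Set
Isomorphic {n} G G′ =
  Σ (Permutation′ n) λ π → ∀ (i j : Fin n) → adj G′ (π ⟨$⟩ʳ i) (π ⟨$⟩ʳ j) ≡ adj G i j

degree : ∀ {n} → SimpleGraph n → Fin n → ℕ
degree G i = Σℕ (λ j → if adj G i j then 1 else 0)

laplacian : ∀ {n} → SimpleGraph n → Fin n → Fin n → ℤ
laplacian G i j =
  if does (i Fin.≟ j) then + degree G i
  else (if adj G i j then -[1+ 0 ] else + 0)

-- L(n): Laplacian of a graph on [suc m] with its last (n-th) column deleted;
-- an n × (n-1) matrix whose rows are points of ℤ^(n-1)
laplacianDel : ∀ {m} → SimpleGraph (suc m) → Fin (suc m) → Fin m → ℤ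
laplacianDel G i k = laplacian G i (inject₁ k)

-- Polytope notions (over ℚ; all polytopes involved are rational)

ℤtoℚ : ℤ → ℚ
ℤtoℚ z = z ℚ./ 1

InConvHull : ∀ {k d} → (Fin k → Fin d → ℚ) → (Fin d → ℚ) → Set
InConvHull {k} {d} v x =
  Σ (Fin k → ℚ) λ c →
    (∀ i → 0ℚ ℚ.≤ c i) × (Σℚ c ≡ 1ℚ) × (∀ t → x t ≡ Σℚ (λ i → c i ℚ.* v i t))

OriginInInterior : ∀ {k d} → (Fin k → Fin d → ℚ) → Set
OriginInInterior {k} {d} v =
  Σ ℚ λ ε → (0ℚ ℚ.< ε) ×
    (∀ (x : Fin d → ℚ) → (∀ t → (ℚ.- ε) ℚ.≤ x t × x t ℚ.≤ ε) → InConvHull v x)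

dot : ∀ {d} → (Fin d → ℚ) → (Fin d → ℚ) → ℚ
dot x y = Σℚ (λ t → x t ℚ.* y t)

InDual : ∀ {k d} → (Fin k → Fin d → ℚ) → (Fin d → ℚ) → Set
InDual {k} {d} v y = ∀ (x : Fin d → ℚ) → InConvHull v x → (ℚ.- 1ℚ) ℚ.≤ dot x y

DualIsLattice : ∀ {k d} → (Fin k → Fin d → ℚ) → Set
DualIsLattice {k} {d} v =
  Σ ℕ λ r → Σ (Fin r → Fin d → ℤ) λ w →
    ∀ (y : Fin d → ℚ) → InDual v y ⇔ InConvHull (λ i t → ℤtoℚ (w i t)) y

Reflexive : ∀ {k d} → (Fin k → Fin d → ℚ) → Set
Reflexive v = OriginInInterior v × DualIsLattice v

laplacianSimplexVerts : ∀ {m} → SimpleGraph (suc m) → Fin (suc m) → Fin m → ℚ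
laplacianSimplexVerts G i k = ℤtoℚ (laplacianDel G i k)

LaplacianSimplexReflexive : ∀ {m} → SimpleGraph (suc m) → Set
LaplacianSimplexReflexive G = Reflexive (laplacianSimplexVerts G)

-- Codes over ℤ_n (elements of ℤ_n represented by Fin n)

Code : ℕ → Set₁
Code n = (Fin n → Fin n) → Set

-- C(P_G) = { x ∈ ℤ_n^n | x [L(n) | 1] = 0 in ℤ_n^n }, n = suc m.
-- The columns of [L(n) | 1] are the m columns of L(n) and the all-ones column.
laplacianCode : ∀ {m} → SimpleGraph (suc m) → Code (suc m)
laplacianCode {m} G x =
  (∀ (k : Fin m) → (+ suc m) ∣ℤ Σℤ (λ i → (+ toℕ (x i)) ℤ.* laplacianDel G i k))
  × ((+ suc m) ∣ℤ Σℤ (λ i → (+ toℕ (x i)) ℤ.* (+ 1)))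

PermutationEquivalent : ∀ {n} → Code n → Code n → Set
PermutationEquivalent {n} C C′ =
  Σ (Permutation′ n) λ σ → ∀ (c : Fin n → Fin n) → C c → C′ (λ i → c (σ ⟨$⟩ʳ i))

-- Every row of a Laplacian sums to zero, so for any x the entries of xL sum to zero; hence the
-- condition on the deleted last column of L is implied by the other columns, and x ∈ C(P_G)
-- says exactly that n divides every entry of xL and the sum of x. An isomorphism π : G → G′
-- conjugates the Laplacians, L′(π i, π j) = L(i, j), so (x ∘ π⁻¹)L′ is a relabelling of xL
-- and x ∘ π⁻¹ ∈ C(P_G′).
module Submission where

open import Defs
open import Algebra.Bundles using (AbelianGroup)
open import Data.Bool using (true; false; if_then_else_)
open import Data.Fin as Fin using (Fin; toℕ; inject₁) renaming (zero to fzero; suc to fsuc)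
open import Data.Fin.Permutation as Perm using (Permutation′; _⟨$⟩ʳ_; _⟨$⟩ˡ_)
open import Data.Fin.Relation.Unary.Top using (view; ‵fromℕ; ‵inj₁)
open import Data.Integer as ℤ using (ℤ; +_; 0ℤ; -[1+_])
open import Data.Integer.Divisibility using () renaming (_∣_ to _∣ᵤ_)
open import Data.Integer.Divisibility.Signed using (_∣_; divides; ∣ᵤ⇒∣; ∣⇒∣ᵤ; ∣m∣n⇒∣m+n; ∣m+n∣m⇒∣n)
open import Data.Nat as ℕ using (ℕ; zero; suc)
open import Data.Product using (_,_)
open import Function using (_∘_; Injection)
open import Function.Properties.Inverse using (↔⇒↣)
open import Relation.Binary.PropositionalEquality
open import Relation.Nullary using (yes; no; does; contradiction)
import Algebra.Properties.CommutativeMonoid.Sum as MonoidSum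
import Algebra.Properties.Group as GroupProperties
import Algebra.Properties.Semiring.Sum as SemiringSum
import Data.Integer.Properties as ℤP
import Data.Nat.Properties as ℕP

module ℤΣ = SemiringSum ℤP.+-*-semiring
module ℕΣ = MonoidSum ℕP.+-0-commutativeMonoid
open ℤΣ using (sum; sum-cong-≗; ∑-permute)
open GroupProperties (AbelianGroup.group ℤP.+-0-abelianGroup) using (identityˡ-unique)

Σℤ≡sum : ∀ {k} (f : Fin k → ℤ) → Σℤ f ≡ sum f
Σℤ≡sum {zero}  f = refl
Σℤ≡sum {suc k} f = cong (ℤ._+_ (f fzero)) (Σℤ≡sum (f ∘ fsuc))

Σℕ≡sum : ∀ {k} (f : Fin k → ℕ) → Σℕ f ≡ ℕΣ.sum f
Σℕ≡sum {zero}  f = refl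
Σℕ≡sum {suc k} f = cong (ℕ._+_ (f fzero)) (Σℕ≡sum (f ∘ fsuc))

+-Σℕ : ∀ {k} (f : Fin k → ℕ) → + Σℕ f ≡ sum (+_ ∘ f)
+-Σℕ {zero}  f = refl
+-Σℕ {suc k} f = cong (ℤ._+_ (+ f fzero)) (+-Σℕ (f ∘ fsuc))

Σℤ-permute : ∀ {k} (π : Permutation′ k) (f : Fin k → ℤ) → Σℤ f ≡ Σℤ (f ∘ (π ⟨$⟩ʳ_))
Σℤ-permute π f = begin
  Σℤ f                  ≡⟨ Σℤ≡sum f ⟩
  sum f                 ≡⟨ ∑-permute f π ⟩
  sum (f ∘ (π ⟨$⟩ʳ_))   ≡⟨ Σℤ≡sum (f ∘ (π ⟨$⟩ʳ_)) ⟨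
  Σℤ (f ∘ (π ⟨$⟩ʳ_))    ∎
  where open ≡-Reasoning

sum-δ : ∀ {k} (i : Fin k) (x : ℤ) → sum (λ j → if does (i Fin.≟ j) then x else 0ℤ) ≡ x
sum-δ {suc k} fzero    x = trans (cong (ℤ._+_ x) (ℤΣ.sum-replicate-zero k)) (ℤP.+-identityʳ x)
sum-δ {suc k} (fsuc i) x = trans (ℤP.+-identityˡ _) (sum-δ i x)

∣0ℤ : ∀ d → d ∣ 0ℤ
∣0ℤ d = divides 0ℤ (sym (ℤP.*-zeroˡ d))

∣-sum : ∀ {k} {d : ℤ} (f : Fin k → ℤ) → (∀ i → d ∣ f i) → d ∣ sum f
∣-sum {zero}  {d} f d∣f = ∣0ℤ d
∣-sum {suc k}     f d∣f = ∣m∣n⇒∣m+n (d∣f fzero) (∣-sum (f ∘ fsuc) (d∣f ∘ fsuc))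

sum≡0∧∣-init⇒∣ : ∀ {m} {d : ℤ} (f : Fin (suc m) → ℤ) → sum f ≡ 0ℤ →
                  (∀ k → d ∣ f (inject₁ k)) → ∀ j → d ∣ f j
sum≡0∧∣-init⇒∣ {m} {d} f Σf≡0 d∣init j with view j
... | ‵inj₁ {i = k} _ = d∣init k
... | ‵fromℕ = ∣m+n∣m⇒∣n d∣Σf (∣-sum (f ∘ inject₁) d∣init)
  where
  d∣Σf : d ∣ sum (f ∘ inject₁) ℤ.+ f (Fin.fromℕ m)
  d∣Σf = subst (d ∣_) (trans (sym Σf≡0) (ℤΣ.sum-init-last f)) (∣0ℤ d)

vecMul : ∀ {m n} → (Fin m → ℤ) → (Fin m → Fin n → ℤ) → Fin n → ℤ
vecMul v M j = sum (λ i → v i ℤ.* M i j)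

sum-vecMul : ∀ {m n} (v : Fin m → ℤ) (M : Fin m → Fin n → ℤ) →
             (∀ i → sum (M i) ≡ 0ℤ) → sum (vecMul v M) ≡ 0ℤ
sum-vecMul {m} v M rows≡0 = begin
  sum (vecMul v M)                            ≡⟨ ℤΣ.∑-comm (λ i j → v i ℤ.* M i j) ⟨
  sum (λ i → sum (λ j → v i ℤ.* M i j))      ≡⟨ sum-cong-≗ (λ i → ℤΣ.*-distribˡ-sum (v i) (M i)) ⟨
  sum (λ i → v i ℤ.* sum (M i))               ≡⟨ sum-cong-≗ (λ i → cong (v i ℤ.*_) (rows≡0 i)) ⟩
  sum (λ i → v i ℤ.* 0ℤ)                      ≡⟨ sum-cong-≗ (ℤP.*-zeroʳ ∘ v) ⟩
  sum {m} (λ _ → 0ℤ)                          ≡⟨ ℤΣ.sum-replicate-zero m ⟩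
  0ℤ                                          ∎
  where open ≡-Reasoning

vecMul-relabel : ∀ {n} (π : Permutation′ n) (v : Fin n → ℤ) (M M′ : Fin n → Fin n → ℤ) →
                 (∀ i j → M′ (π ⟨$⟩ʳ i) (π ⟨$⟩ʳ j) ≡ M i j) →
                 ∀ j → vecMul (v ∘ (π ⟨$⟩ˡ_)) M′ j ≡ vecMul v M (π ⟨$⟩ˡ j)
vecMul-relabel π v M M′ M′∘π≡M j = begin
  sum (λ i → v (π ⟨$⟩ˡ i) ℤ.* M′ i j)                             ≡⟨ ∑-permute _ π ⟩
  sum (λ i → v (π ⟨$⟩ˡ (π ⟨$⟩ʳ i)) ℤ.* M′ (π ⟨$⟩ʳ i) j)           ≡⟨ sum-cong-≗ entry ⟩
  sum (λ i → v i ℤ.* M i (π ⟨$⟩ˡ j))                              ∎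
  where
  open ≡-Reasoning
  entry : ∀ i → v (π ⟨$⟩ˡ (π ⟨$⟩ʳ i)) ℤ.* M′ (π ⟨$⟩ʳ i) j ≡ v i ℤ.* M i (π ⟨$⟩ˡ j)
  entry i = cong₂ (λ a b → v a ℤ.* b) (Perm.inverseˡ π)
              (trans (cong (M′ (π ⟨$⟩ʳ i)) (sym (Perm.inverseʳ π))) (M′∘π≡M i (π ⟨$⟩ˡ j)))

adjacency : ∀ {n} → SimpleGraph n → Fin n → Fin n → ℕ
adjacency G i j = if adj G i j then 1 else 0

laplacian+adjacency : ∀ {n} (G : SimpleGraph n) (i j : Fin n) →
  laplacian G i j ℤ.+ + adjacency G i j ≡ (if does (i Fin.≟ j) then + degree G i else 0ℤ)
laplacian+adjacency G i j with i Fin.≟ j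
... | yes refl rewrite irrefl G i = ℤP.+-identityʳ _
... | no _ with adj G i j
...   | true  = refl
...   | false = refl

sum-laplacian-row : ∀ {n} (G : SimpleGraph n) (i : Fin n) → sum (laplacian G i) ≡ 0ℤ
sum-laplacian-row G i = identityˡ-unique (sum (laplacian G i)) (+ degree G i) (begin
  sum (laplacian G i) ℤ.+ + degree G i                     ≡⟨ cong (ℤ._+_ (sum (laplacian G i))) (+-Σℕ (adjacency G i)) ⟩
  sum (laplacian G i) ℤ.+ sum (+_ ∘ adjacency G i)         ≡⟨ ℤΣ.∑-distrib-+ (laplacian G i) (+_ ∘ adjacency G i) ⟨
  sum (λ j → laplacian G i j ℤ.+ + adjacency G i j)        ≡⟨ sum-cong-≗ (laplacian+adjacency G i) ⟩
  sum (λ j → if does (i Fin.≟ j) then + degree G i else 0ℤ) ≡⟨ sum-δ i (+ degree G i) ⟩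
  + degree G i                                             ∎)
  where open ≡-Reasoning

module _ {n : ℕ} (G G′ : SimpleGraph n) (π : Permutation′ n)
         (iso : ∀ i j → adj G′ (π ⟨$⟩ʳ i) (π ⟨$⟩ʳ j) ≡ adj G i j) where

  degree-iso : ∀ i → degree G′ (π ⟨$⟩ʳ i) ≡ degree G i
  degree-iso i = begin
    Σℕ (adjacency G′ (π ⟨$⟩ʳ i))                     ≡⟨ Σℕ≡sum (adjacency G′ (π ⟨$⟩ʳ i)) ⟩
    ℕΣ.sum (adjacency G′ (π ⟨$⟩ʳ i))                 ≡⟨ ℕΣ.∑-permute _ π ⟩
    ℕΣ.sum (adjacency G′ (π ⟨$⟩ʳ i) ∘ (π ⟨$⟩ʳ_))    ≡⟨ ℕΣ.sum-cong-≗ (cong (if_then 1 else 0) ∘ iso i) ⟩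
    ℕΣ.sum (adjacency G i)                           ≡⟨ Σℕ≡sum (adjacency G i) ⟨
    Σℕ (adjacency G i)                               ∎
    where open ≡-Reasoning

  laplacian-iso : ∀ i j → laplacian G′ (π ⟨$⟩ʳ i) (π ⟨$⟩ʳ j) ≡ laplacian G i j
  laplacian-iso i j with i Fin.≟ j | π ⟨$⟩ʳ i Fin.≟ π ⟨$⟩ʳ j
  ... | yes refl | yes _       = cong +_ (degree-iso i)
  ... | yes refl | no πi≢πi    = contradiction refl πi≢πi
  ... | no i≢j   | yes πi≡πj   = contradiction (Injection.injective (↔⇒↣ π) πi≡πj) i≢j
  ... | no _     | no _        = cong (if_then -[1+ 0 ] else 0ℤ) (iso i j)

liftℤ : ∀ {n} → (Fin n → Fin n) → Fin n → ℤ
liftℤ x i = + toℕ (x i)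

laplacianCode⇒∣vecMul : ∀ {m} (G : SimpleGraph (suc m)) (x : Fin (suc m) → Fin (suc m)) →
                        laplacianCode G x → ∀ j → + suc m ∣ vecMul (liftℤ x) (laplacian G) j
laplacianCode⇒∣vecMul G x (n∣columns , _) =
  sum≡0∧∣-init⇒∣ (vecMul (liftℤ x) (laplacian G))
    (sum-vecMul (liftℤ x) (laplacian G) (sum-laplacian-row G))
    (λ k → subst (_ ∣_) (Σℤ≡sum (λ i → liftℤ x i ℤ.* laplacian G i (inject₁ k)))
                 (∣ᵤ⇒∣ (n∣columns k)))

theorem4p2 : (m : ℕ) (G G′ : SimpleGraph (suc m))
    → Connected G → Connected G′
    → Isomorphic G G′
    → LaplacianSimplexReflexive G → LaplacianSimplexReflexive G′
    → PermutationEquivalent (laplacianCode G) (laplacianCode G′)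
theorem4p2 m G G′ _ _ (π , iso) _ _ = Perm.flip π , λ c c∈C@(_ , n∣Σc) →
    (λ k → ∣⇒∣ᵤ (subst (+ suc m ∣_) (column-relabel c k)
                   (laplacianCode⇒∣vecMul G c c∈C (π ⟨$⟩ˡ inject₁ k))))
  , subst (+ suc m ∣ᵤ_) (Σℤ-permute (Perm.flip π) (λ i → liftℤ c i ℤ.* + 1)) n∣Σc
  where
  column-relabel : ∀ c k → vecMul (liftℤ c) (laplacian G) (π ⟨$⟩ˡ inject₁ k)
                         ≡ Σℤ (λ i → liftℤ c (π ⟨$⟩ˡ i) ℤ.* laplacianDel G′ i k)
  column-relabel c k = begin
    vecMul (liftℤ c) (laplacian G) (π ⟨$⟩ˡ inject₁ k)
      ≡⟨ vecMul-relabel π (liftℤ c) (laplacian G) (laplacian G′) (laplacian-iso G G′ π iso) (inject₁ k) ⟨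
    vecMul (liftℤ c ∘ (π ⟨$⟩ˡ_)) (laplacian G′) (inject₁ k)
      ≡⟨ Σℤ≡sum (λ i → liftℤ c (π ⟨$⟩ˡ i) ℤ.* laplacianDel G′ i k) ⟨
    Σℤ (λ i → liftℤ c (π ⟨$⟩ˡ i) ℤ.* laplacianDel G′ i k)
      ∎
    where open ≡-Reasoning
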